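{- For the elementary cellular automaton $F_5$ and every nonempty finite word $u\in\{0,1\}^*$, $D(\textsc{SInv}_{F_5,u,n})\in O(1)$ as $n\to\infty$.
   Context: The ECA with Wolfram number $N$ is $F_N:\{0,1\}^{\mathbb{Z}}\to\{0,1\}^{\mathbb{Z}}$, $(F_N(x))_i=f_N(x_{i-1},x_i,x_{i+1})$, where $f_N(a,b,c)$ is the bit of index $4a+2b+c$ of $N$ in binary. For a nonempty word $u$, $p_u\in\{0,1\}^{\mathbb{Z}}$ is $(p_u)_i=u_{i\bmod |u|}$; for a finite word $x$, $p_u[x]$ equals $x$ on positions $\{0,\dots,|x|-1\}$ and $p_u$ elsewhere. $\textsc{SInv}_{F,u,n}:\{0,1\}^n\to\{0,1\}$ maps $x$ to $1$ iff there is an integer $w$ such that for every $t\ge 0$ the set of positions where $F^t(p_u)$ and $F^t(p_u[x])$ differ is contained in an interval of length $w$. For finite sets $X,Y,Z$ and $g:X\times Y\to Z$, $D(g)$ is the minimal depth of a deterministic two-party communication protocol tree computing $g$ (Alice knows $x$, Bob knows $y$; internal nodes are labelled by a function of $x$ alone or of $y$ alone to $\{\mathrm{l},\mathrm{r}\}$, leaves by outputs). For $g:\{0,1\}^m\to Z$, $D(g)=\max_{0\le i\le m} D(g_i)$ with $g_i(x,y)=g(xy)$ for $x\in\{0,1\}^i$, $y\in\{0,1\}^{m-i}$. -}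

module Defs where

open import Data.Bool using (Bool; true; false; if_then_else_; _∧_)
open import Data.Nat as ℕ using (ℕ; zero; suc; _^_; _≡ᵇ_)
open import Data.Nat.DivMod using (_/_; _%_)
open import Data.Integer as ℤ using (ℤ; +_; _%ℕ_)
open import Data.Integer.DivMod using (n%ℕd<d)
open import Data.Fin using (Fin; fromℕ<)
open import Data.Vec using (Vec; lookup; _++_)
open import Data.Product using (Σ; ∃; _×_; _,_)
open import Relation.Binary.PropositionalEquality using (_≡_; _≢_; subst)
open import Function.Bundles using (_⇔_)
open import Relation.Nullary using (yes; no)

-- Configurations of {0,1}^ℤ (0 = false, 1 = true)
Config : Set
Config = ℤ → Bool

toℕ𝔹 : Bool → ℕ
toℕ𝔹 false = 0
toℕ𝔹 true  = 1

bit : ℕ → ℕ → Bool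
bit N zero    = (N % 2) ≡ᵇ 1
bit N (suc k) = bit (N / 2) k

localRule : ℕ → Bool → Bool → Bool → Bool
localRule N a b c = bit N (4 ℕ.* toℕ𝔹 a ℕ.+ 2 ℕ.* toℕ𝔹 b ℕ.+ toℕ𝔹 c)

ECA : ℕ → Config → Config
ECA N x i = localRule N (x (i ℤ.- + 1)) (x i) (x (i ℤ.+ + 1))

iter : (Config → Config) → ℕ → Config → Config
iter F zero    x = x
iter F (suc t) x = F (iter F t x)

periodic : ∀ {k} → Vec Bool (suc k) → Config
periodic {k} u i = lookup u (fromℕ< (n%ℕd<d i (suc k)))

patch : ∀ {k n} → Vec Bool (suc k) → Vec Bool n → Config
patch {k} {n} u x (+ j) with j ℕ.<? n
... | yes j<n = lookup x (fromℕ< j<n)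
... | no _   = periodic u (+ j)
patch u x i@(ℤ.-[1+ _ ]) = periodic u i

SInv : ℕ → ∀ {k n} → Vec Bool (suc k) → Vec Bool n → Set
SInv N u x =
  ∃ λ (w : ℕ) → (t : ℕ) → ∃ λ (a : ℤ) → (i : ℤ) →
    iter (ECA N) t (periodic u) i ≢ iter (ECA N) t (patch u x) i →
    (a ℤ.≤ i) × (i ℤ.< a ℤ.+ + w)

-- Deterministic two-party protocol trees (false = l, true = r)
data Protocol (X Y Z : Set) : Set where
  leaf  : Z → Protocol X Y Z
  alice : (X → Bool) → Protocol X Y Z → Protocol X Y Z → Protocol X Y Z
  bob   : (Y → Bool) → Protocol X Y Z → Protocol X Y Z → Protocol X Y Z

depth : ∀ {X Y Z} → Protocol X Y Z → ℕ
depth (leaf _)      = 0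
depth (alice _ l r) = suc (depth l ℕ.⊔ depth r)
depth (bob _ l r)   = suc (depth l ℕ.⊔ depth r)

run : ∀ {X Y Z} → Protocol X Y Z → X → Y → Z
run (leaf z)      x y = z
run (alice f l r) x y = if f x then run r x y else run l x y
run (bob g l r)   x y = if g y then run r x y else run l x y

-- D(g) ≤ C for the Boolean function g : X × Y → {0,1} whose value is 1
-- exactly when the predicate G holds (1 = true).
DAtMost : ∀ {X Y : Set} → ℕ → (X → Y → Set) → Set
DAtMost {X} {Y} C G =
  Σ (Protocol X Y Bool) λ P → (depth P ℕ.≤ C) ×
    ((x : X) (y : Y) → (run P x y ≡ true) ⇔ G x y)

-- D(g) ≤ C for g : {0,1}^m → {0,1} (given by predicate G): for every split
-- m = i + j, D(g_i) ≤ C where g_i(x,y) = g(xy).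
DWordAtMost : ℕ → (m : ℕ) → (Vec Bool m → Set) → Set
DWordAtMost C m G =
  (i j : ℕ) (e : i ℕ.+ j ≡ m) →
    DAtMost {Vec Bool i} {Vec Bool j} C (λ x y → G (subst (Vec Bool) e (x ++ y)))

module Submission where

-- The square of F₅ is x ↦ (i ↦ xᵢ ∨ (xᵢ₋₂ ∧ xᵢ₊₂)), which is idempotent, so F₅⁴ = F₅² and
-- every iterate of F₅ equals one of F₅⁰, …, F₅³. A finite perturbation spreads by at most
-- one cell per step, so after any number of steps p_u and p_u[x] still differ only within
-- a window of fixed width: SInv_{F₅,u,n} is constantly 1, computed by the depth-0 protocol.

open import Defs
open import Data.Bool using (Bool; true; false; not; _∧_; _∨_)
open import Data.Nat as ℕ using (ℕ; zero; suc; _≥_; z≤n; s≤s)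
import Data.Nat.Properties as ℕP
open import Data.Integer as ℤ using (ℤ; +_; -[1+_]; _+_; _-_; _≤_; _<_)
import Data.Integer.Properties as ℤP
open import Data.Integer.Tactic.RingSolver using (solve-∀)
open import Data.Vec using (Vec)
open import Data.Product using (∃; _,_; _×_)
open import Data.Sum using (_⊎_; inj₁; inj₂)
open import Data.Empty using (⊥-elim)
open import Function.Bundles using (mk⇔)
open import Relation.Binary.PropositionalEquality
open import Relation.Nullary using (yes; no)

ECA-local : ∀ N {x y} i → x (i - + 1) ≡ y (i - + 1) → x i ≡ y i → x (i + + 1) ≡ y (i + + 1) →
  ECA N x i ≡ ECA N y i
ECA-local N i left centre right rewrite left | centre | right = refl

ECA-cong : ∀ N {x y} → x ≗ y → ECA N x ≗ ECA N y
ECA-cong N {x} {y} x≗y i = ECA-local N {x} {y} i (x≗y (i - + 1)) (x≗y i) (x≗y (i + + 1))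

-- F^(m + 1 + d) = F^m: preperiod m, period d + 1.
EventuallyPeriodic : (Config → Config) → ℕ → ℕ → Set
EventuallyPeriodic F m d = ∀ x → iter F (suc (m ℕ.+ d)) x ≗ iter F m x

iter≗iter-below-period : ∀ {F m d} → (∀ {x y} → x ≗ y → F x ≗ F y) →
  EventuallyPeriodic F m d →
  ∀ t → ∃ λ t' → t' ℕ.< suc (m ℕ.+ d) × (∀ x → iter F t x ≗ iter F t' x)
iter≗iter-below-period F-cong periodic-F zero = 0 , s≤s z≤n , λ x i → refl
iter≗iter-below-period {F} {m} {d} F-cong periodic-F (suc t)
  with iter≗iter-below-period {F} {m} {d} F-cong periodic-F t
... | t' , t'<T , eq with ℕP.m≤n⇒m<n∨m≡n t'<T
...   | inj₁ t'+1<T = suc t' , t'+1<T , λ x → F-cong (eq x)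
...   | inj₂ refl   = m , s≤s (ℕP.m≤m+n m d) , λ x i → trans (F-cong (eq x) i) (periodic-F x i)

Outside : ℤ → ℤ → ℤ → Set
Outside a b i = i < a ⊎ b ≤ i

AgreeOutside : Config → Config → ℤ → ℤ → Set
AgreeOutside x y a b = ∀ i → Outside a b i → x i ≡ y i

AgreeOutside-mono : ∀ {x y a a' b b'} → a' ≤ a → b ≤ b' →
  AgreeOutside x y a b → AgreeOutside x y a' b'
AgreeOutside-mono a'≤a b≤b' agree i (inj₁ i<a') = agree i (inj₁ (ℤP.<-≤-trans i<a' a'≤a))
AgreeOutside-mono a'≤a b≤b' agree i (inj₂ b'≤i) = agree i (inj₂ (ℤP.≤-trans b≤b' b'≤i))

AgreeOutside-resp-≗ : ∀ {x x' y y' a b} → x ≗ x' → y ≗ y' →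
  AgreeOutside x' y' a b → AgreeOutside x y a b
AgreeOutside-resp-≗ x≗x' y≗y' agree i out = trans (x≗x' i) (trans (agree i out) (sym (y≗y' i)))

disagreement-inside : ∀ {x y a b} → AgreeOutside x y a b →
  ∀ i → x i ≢ y i → a ≤ i × i < b
disagreement-inside {a = a} {b} agree i differ with i ℤP.<? a | b ℤP.≤? i
... | yes i<a | _       = ⊥-elim (differ (agree i (inj₁ i<a)))
... | no _    | yes b≤i = ⊥-elim (differ (agree i (inj₂ b≤i)))
... | no i≮a  | no b≰i  = ℤP.≮⇒≥ i≮a , ℤP.≰⇒> b≰i

Outside-neighbour : ∀ {a b i j} → i - + 1 ≤ j → j ≤ i + + 1 →
  Outside (a - + 1) (b + + 1) i → Outside a b j
Outside-neighbour {a} {b} {i} {j} _ j≤i+1 (inj₁ i<a-1) = inj₁ (begin-strict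
  j                   ≤⟨ j≤i+1 ⟩
  i + + 1             <⟨ ℤP.+-monoˡ-< (+ 1) i<a-1 ⟩
  (a - + 1) + + 1     ≡⟨ ℤP.+-assoc a (ℤ.- + 1) (+ 1) ⟩
  a + + 0             ≡⟨ ℤP.+-identityʳ a ⟩
  a                   ∎)
  where open ℤP.≤-Reasoning
Outside-neighbour {a} {b} {i} {j} i-1≤j _ (inj₂ b+1≤i) = inj₂ (begin
  b                   ≡⟨ ℤP.+-identityʳ b ⟨
  b + + 0             ≡⟨ ℤP.+-assoc b (+ 1) (ℤ.- + 1) ⟨
  (b + + 1) - + 1     ≤⟨ ℤP.+-monoˡ-≤ (ℤ.- + 1) b+1≤i ⟩
  i - + 1             ≤⟨ i-1≤j ⟩
  j                   ∎)
  where open ℤP.≤-Reasoning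

ECA-AgreeOutside : ∀ N {x y a b} → AgreeOutside x y a b →
  AgreeOutside (ECA N x) (ECA N y) (a - + 1) (b + + 1)
ECA-AgreeOutside N {x} {y} agree i out = ECA-local N {x} {y} i
  (agree (i - + 1) (Outside-neighbour ℤP.≤-refl i-1≤i+1 out))
  (agree i (Outside-neighbour i-1≤i i≤i+1 out))
  (agree (i + + 1) (Outside-neighbour i-1≤i+1 ℤP.≤-refl out))
  where
  i-1≤i : i - + 1 ≤ i
  i-1≤i = ℤP.i-j≤i i (+ 1)
  i≤i+1 : i ≤ i + + 1
  i≤i+1 = ℤP.i≤i+j i (+ 1)
  i-1≤i+1 : i - + 1 ≤ i + + 1
  i-1≤i+1 = ℤP.≤-trans i-1≤i i≤i+1

iter-ECA-AgreeOutside : ∀ N t {x y a b} → AgreeOutside x y a b →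
  AgreeOutside (iter (ECA N) t x) (iter (ECA N) t y) (a - + t) (b + + t)
iter-ECA-AgreeOutside N zero {a = a} {b} agree =
  subst₂ (AgreeOutside _ _) (sym (ℤP.+-identityʳ a)) (sym (ℤP.+-identityʳ b)) agree
iter-ECA-AgreeOutside N (suc t) {a = a} {b} agree =
  subst₂ (AgreeOutside _ _) left right (ECA-AgreeOutside N (iter-ECA-AgreeOutside N t agree))
  where
  left : (a - + t) - + 1 ≡ a - + suc t
  left = trans (ℤP.+-comm (a - + t) (ℤ.- + 1)) (sym (ℤP.minus-suc a t))
  right : (b + + t) + + 1 ≡ b + + suc t
  right = trans (ℤP.+-assoc b (+ t) (+ 1)) (cong (λ w → b + + w) (ℕP.+-comm t 1))

patch-AgreeOutside : ∀ {k n} (u : Vec Bool (suc k)) (v : Vec Bool n) →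
  AgreeOutside (periodic u) (patch u v) (+ 0) (+ n)
patch-AgreeOutside u v -[1+ j ] out = refl
patch-AgreeOutside u v (+ j) (inj₁ (ℤ.+<+ ()))
patch-AgreeOutside {n = n} u v (+ j) (inj₂ (ℤ.+≤+ n≤j)) with j ℕ.<? n
... | yes j<n = ⊥-elim (ℕP.<⇒≱ j<n n≤j)
... | no _    = refl

SInv-of-eventually-periodic : ∀ {N m d} → EventuallyPeriodic (ECA N) m d →
  ∀ {k n} (u : Vec Bool (suc k)) (v : Vec Bool n) → SInv N u v
SInv-of-eventually-periodic {N} {m} {d} periodic-F {n = n} u v =
  T ℕ.+ (n ℕ.+ T) , λ t → a , disagreement-inside (agree t)
  where
  T : ℕ
  T = suc (m ℕ.+ d)
  a : ℤ
  a = + 0 - + T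
  width : + n + + T ≡ a + + (T ℕ.+ (n ℕ.+ T))
  width = begin
    + n + + T                      ≡⟨ cancel (+ T) (+ n) ⟩
    a + (+ T + (+ n + + T))        ≡⟨ cong (λ w → a + (+ T + w)) (sym (ℤP.pos-+ n T)) ⟩
    a + (+ T + + (n ℕ.+ T))        ≡⟨ cong (λ w → a + w) (sym (ℤP.pos-+ T (n ℕ.+ T))) ⟩
    a + + (T ℕ.+ (n ℕ.+ T))        ∎
    where
    open ≡-Reasoning
    cancel : ∀ x y → y + x ≡ (+ 0 - x) + (x + (y + x))
    cancel = solve-∀
  agree : ∀ t → AgreeOutside (iter (ECA N) t (periodic u)) (iter (ECA N) t (patch u v))
                             a (a + + (T ℕ.+ (n ℕ.+ T)))
  agree t with iter≗iter-below-period {ECA N} {m} {d} (ECA-cong N) periodic-F t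
  ... | t' , t'<T , early = AgreeOutside-resp-≗ (early _) (early _)
    (AgreeOutside-mono a≤ b≤ (iter-ECA-AgreeOutside N t' (patch-AgreeOutside u v)))
    where
    t'≤T : + t' ≤ + T
    t'≤T = ℤ.+≤+ (ℕP.<⇒≤ t'<T)
    a≤ : a ≤ + 0 - + t'
    a≤ = ℤP.+-monoʳ-≤ (+ 0) (ℤP.neg-mono-≤ t'≤T)
    b≤ : + n + + t' ≤ a + + (T ℕ.+ (n ℕ.+ T))
    b≤ = ℤP.≤-trans (ℤP.+-monoʳ-≤ (+ n) t'≤T) (ℤP.≤-reflexive width)

ECA5 : ∀ x i → ECA 5 x i ≡ not (x (i - + 1)) ∧ not (x (i + + 1))
ECA5 x i = rule (x (i - + 1)) (x i) (x (i + + 1))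
  where
  rule : ∀ a b c → localRule 5 a b c ≡ not a ∧ not c
  rule false false false = refl
  rule false false true  = refl
  rule false true  false = refl
  rule false true  true  = refl
  rule true  false false = refl
  rule true  false true  = refl
  rule true  true  false = refl
  rule true  true  true  = refl

ECA5-square : ∀ x i → ECA 5 (ECA 5 x) i ≡ x i ∨ (x (i - + 2) ∧ x (i + + 2))
ECA5-square x i
  rewrite ECA5 (ECA 5 x) i | ECA5 x (i - + 1) | ECA5 x (i + + 1)
        | ℤP.+-assoc i (ℤ.- + 1) (ℤ.- + 1) | ℤP.+-assoc i (ℤ.- + 1) (+ 1)
        | ℤP.+-assoc i (+ 1) (ℤ.- + 1) | ℤP.+-assoc i (+ 1) (+ 1) | ℤP.+-identityʳ i
  = square (x (i - + 2)) (x i) (x (i + + 2))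
  where
  square : ∀ a b c → not (not a ∧ not b) ∧ not (not b ∧ not c) ≡ b ∨ (a ∧ c)
  square false false c     = refl
  square false true  c     = refl
  square true  false false = refl
  square true  false true  = refl
  square true  true  c     = refl

ECA5-eventually-periodic : EventuallyPeriodic (ECA 5) 2 1
ECA5-eventually-periodic x i
  rewrite ECA5-square (ECA 5 (ECA 5 x)) i
        | ECA5-square x i | ECA5-square x (i - + 2) | ECA5-square x (i + + 2)
        | ℤP.+-assoc i (ℤ.- + 2) (+ 2) | ℤP.+-assoc i (+ 2) (ℤ.- + 2) | ℤP.+-identityʳ i
  = idempotent (x i) (x (i - + 2)) (x (i + + 2)) (x ((i - + 2) - + 2)) (x ((i + + 2) + + 2))
  where
  idempotent : ∀ a b c d e → (a ∨ b ∧ c) ∨ (b ∨ d ∧ a) ∧ (c ∨ a ∧ e) ≡ a ∨ b ∧ c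
  idempotent true  b     c     d     e = refl
  idempotent false false c     false e = refl
  idempotent false false c     true  e = refl
  idempotent false true  false d     e = refl
  idempotent false true  true  d     e = refl

DWordAtMost-zero : ∀ {m} {G : Vec Bool m → Set} → (∀ x → G x) → DWordAtMost 0 m G
DWordAtMost-zero G-holds i j e = leaf true , z≤n , λ x y → mk⇔ (λ _ → G-holds _) (λ _ → refl)

proposition4 : ∀ {k} (u : Vec Bool (suc k)) →
    ∃ λ (C : ℕ) → ∃ λ (N₀ : ℕ) → (n : ℕ) → n ≥ N₀ →
      DWordAtMost C n (λ x → SInv 5 u x)
proposition4 u = 0 , 0 , λ n _ →
  DWordAtMost-zero (SInv-of-eventually-periodic {5} {2} {1} ECA5-eventually-periodic u)
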